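{- Let $G$ be a connected graph on $n$ vertices with maximum degree at most $\Delta$, containing exactly one sink $s$, and let $\sigma$ be a configuration with $N$ chips in total on the non-sink vertices. Then the following greedy simulation algorithm terminates after $O(\Delta^2n^3\log(nN))$ iterations: while some non-sink vertex is full, choose a non-sink vertex $u$ maximizing $\lfloor\sigma_u/\deg(u)\rfloor$, let $k=\lfloor\sigma_u/\deg(u)\rfloor$, set $\sigma_u\leftarrow\sigma_u-k\deg(u)$ and add $k$ chips to every non-sink neighbor of $u$ (one iteration = one execution of this loop body).
   Context: Sandpile with a sink: $\sigma\in\mathbb{N}^{V(G)}$ gives chip counts; the sink never fires and chips sent to it are discarded; a non-sink vertex $v$ is full if $\sigma_v\ge\deg(v)$ (degree counts all neighbors, including $s$); firing $v$ decreases $\sigma_v$ by $\deg(v)$ and adds one chip to each neighbor; a configuration is terminal if no non-sink vertex is full. Graphs are undirected, unweighted and simple. -}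

module Defs where

open import Data.Nat using (ℕ; zero; suc; _+_; _*_; _∸_; _≤_; _/_)
open import Data.Fin using (Fin; _≟_)
open import Data.Bool using (Bool; true; false; if_then_else_; _∧_; not)
open import Data.List using (List; map; allFin)
open import Data.Nat.ListAction using (sum)
open import Relation.Binary.PropositionalEquality using (_≡_; _≢_)
open import Relation.Nullary using (does)

record Graph (n : ℕ) : Set where
  field
    adj    : Fin n → Fin n → Bool
    sym    : ∀ u v → adj u v ≡ adj v u
    irrefl : ∀ v → adj v v ≡ false
open Graph public

-- degree = number of neighbours (the sink counts as a neighbour)
deg : ∀ {n} → Graph n → Fin n → ℕ
deg {n} G v = sum (map (λ w → if adj G v w then 1 else 0) (allFin n))

data Reach {n} (G : Graph n) : Fin n → Fin n → Set where
  here : ∀ {v} → Reach G v v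
  step : ∀ {u v w} → adj G u v ≡ true → Reach G v w → Reach G u w

Connected : ∀ {n} → Graph n → Set
Connected {n} G = ∀ (u v : Fin n) → Reach G u v

MaxDegreeAtMost : ∀ {n} → Graph n → ℕ → Set
MaxDegreeAtMost G Δ = ∀ v → deg G v ≤ Δ

Config : ℕ → Set
Config n = Fin n → ℕ

chipsOffSink : ∀ {n} → Fin n → Config n → ℕ
chipsOffSink {n} s σ =
  sum (map (λ v → if does (v ≟ s) then 0 else σ v) (allFin n))

-- floor division, with the (never used for non-sink vertices of a
-- connected graph with ≥ 2 vertices) convention m / 0 = 0
divFloor : ℕ → ℕ → ℕ
divFloor m zero    = 0
divFloor m (suc d) = m / suc d

quot : ∀ {n} → Graph n → Config n → Fin n → ℕ
quot G σ v = divFloor (σ v) (deg G v)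

greedyFire : ∀ {n} → Graph n → Fin n → Config n → Fin n → Config n
greedyFire G s σ u v =
  if does (v ≟ u) then σ u ∸ quot G σ u * deg G u
  else (if (adj G u v ∧ not (does (v ≟ s))) then σ v + quot G σ u else σ v)

data GreedyStep {n} (G : Graph n) (s : Fin n) (σ : Config n) : Config n → Set where
  greedy : (u : Fin n) → u ≢ s → deg G u ≤ σ u →
           (∀ v → v ≢ s → quot G σ v ≤ quot G σ u) →
           GreedyStep G s σ (greedyFire G s σ u)

data GreedyRun {n} (G : Graph n) (s : Fin n) : ℕ → Config n → Config n → Set where
  done : ∀ {σ} → GreedyRun G s 0 σ σ
  next : ∀ {k σ σ' τ} → GreedyStep G s σ σ' → GreedyRun G s k σ' τ →
         GreedyRun G s (suc k) σ τ

-- Let O be the odometer of a run (how much each vertex has fired in total). Chip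
-- conservation says the final configuration is σ − L O ≥ 0, L the Laplacian. Summed
-- over a level set {O ≥ t}, which avoids the sink, the edges inside cancel, so each
-- edge leaving it has gap O x − O y ≤ N; walking from any vertex to the sink, where
-- O = 0, gives O ≤ nN, so at most n²N chips are fired altogether. If a greedy step
-- fires x, every pile is below (x + 1)Δ, so what remains to be fired is at most
-- 2Δn³·x: the remaining work halves every 2Δn³ steps, and it starts below (nN)².

module Submission where

open import Defs hiding (sym)
open import Data.Bool using (Bool; true; false; if_then_else_; not)
open import Data.Empty using (⊥-elim)
open import Data.Fin using (Fin; zero; suc; _≟_)
open import Data.Fin.Properties using (suc-injective)
open import Data.List using (List; []; _∷_; length; drop; map; allFin; tabulate)
open import Data.List.Properties using (map-tabulate; length-drop; drop-[])
open import Data.Nat using (ℕ; zero; suc; _+_; _*_; _∸_; _^_; _≤_; _<_; _≤ᵇ_; _<ᵇ_; _≤?_; _<?_; z≤n; s≤s; _/_; _%_; >-nonZero)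
open import Data.Nat.DivMod using (m/n*n≤m; m≥n⇒m/n>0; m≡m%n+[m/n]*n; m%n<n)
open import Data.Nat.Induction using (<-wellFounded)
open import Data.Nat.ListAction using () renaming (sum to sumˡ)
open import Data.Nat.Logarithm using (⌊log₂_⌋; ⌊log₂⌋-mono-≤; ⌊log₂[2^n]⌋≡n)
open import Data.Nat.Properties hiding (suc-injective; _≟_)
open import Data.Nat.Tactic.RingSolver using (solve-∀)
open import Data.Product using (∃; _×_; _,_)
open import Function using (_∘_; id; _on_)
open import Induction.WellFounded using (Acc; acc)
open import Relation.Binary.Construct.On as On using ()
open import Relation.Binary.PropositionalEquality
open import Relation.Nullary using (yes; no; does)
open import Relation.Nullary.Reflects using (ofʸ; ofⁿ)
open import Algebra.Properties.Semiring.Sum +-*-semiring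
  using (sum; ∑-distrib-+; ∑-comm; sum-cong-≗; *-distribˡ-sum; *-distribʳ-sum; sum-replicate-zero)

sumˡ-allFin : ∀ {n} (f : Fin n → ℕ) → sumˡ (map f (allFin n)) ≡ sum f
sumˡ-allFin {n} f = trans (cong sumˡ (map-tabulate id f)) (sumˡ-tabulate f)
  where
  sumˡ-tabulate : ∀ {m} (g : Fin m → ℕ) → sumˡ (tabulate g) ≡ sum g
  sumˡ-tabulate {zero} g = refl
  sumˡ-tabulate {suc m} g = cong (g zero +_) (sumˡ-tabulate (g ∘ suc))

sum-mono-≤ : ∀ {n} {f g : Fin n → ℕ} → (∀ i → f i ≤ g i) → sum f ≤ sum g
sum-mono-≤ {zero} _ = z≤n
sum-mono-≤ {suc n} f≤g = +-mono-≤ (f≤g zero) (sum-mono-≤ (f≤g ∘ suc))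

sum-mono-< : ∀ {n} {f g : Fin n → ℕ} → (∀ i → f i ≤ g i) → ∀ i → f i < g i → sum f < sum g
sum-mono-< f≤g zero fi<gi = +-mono-<-≤ fi<gi (sum-mono-≤ (f≤g ∘ suc))
sum-mono-< f≤g (suc i) fi<gi = +-mono-≤-< (f≤g zero) (sum-mono-< (f≤g ∘ suc) i fi<gi)

sum≤n*c : ∀ {n} {f : Fin n → ℕ} c → (∀ i → f i ≤ c) → sum f ≤ n * c
sum≤n*c {zero} c _ = z≤n
sum≤n*c {suc n} c f≤c = +-mono-≤ (f≤c zero) (sum≤n*c c (f≤c ∘ suc))

term≤sum : ∀ {n} (f : Fin n → ℕ) i → f i ≤ sum f
term≤sum f zero = m≤m+n _ _
term≤sum f (suc i) = ≤-trans (term≤sum (f ∘ suc) i) (m≤n+m _ _)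

sum-supportedAt : ∀ {n} (f : Fin n → ℕ) i → (∀ j → j ≢ i → f j ≡ 0) → sum f ≡ f i
sum-supportedAt {suc n} f zero f≡0 = begin
  f zero + sum (f ∘ suc)       ≡⟨ cong (f zero +_) (sum-cong-≗ λ j → f≡0 (suc j) λ ()) ⟩
  f zero + sum {n} (λ _ → 0)   ≡⟨ cong (f zero +_) (sum-replicate-zero n) ⟩
  f zero + 0                   ≡⟨ +-identityʳ _ ⟩
  f zero                       ∎
  where open ≡-Reasoning
sum-supportedAt {suc n} f (suc i) f≡0 =
  cong₂ _+_ (f≡0 zero λ ()) (sum-supportedAt (f ∘ suc) i λ j j≢i → f≡0 (suc j) (j≢i ∘ suc-injective))

sum-∸ : ∀ {n} {f g : Fin n → ℕ} → (∀ i → g i ≤ f i) → sum f ∸ sum g ≡ sum (λ i → f i ∸ g i)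
sum-∸ {f = f} {g} g≤f = begin
  sum f ∸ sum g                           ≡⟨ cong (_∸ sum g) (sum-cong-≗ λ i → sym (m+[n∸m]≡n (g≤f i))) ⟩
  sum (λ i → g i + (f i ∸ g i)) ∸ sum g   ≡⟨ cong (_∸ sum g) (∑-distrib-+ g _) ⟩
  sum g + sum (λ i → f i ∸ g i) ∸ sum g   ≡⟨ m+n∸m≡n (sum g) _ ⟩
  sum (λ i → f i ∸ g i)                   ∎
  where open ≡-Reasoning

term∸term≤sum∸sum : ∀ {n} {f g : Fin n → ℕ} → (∀ i → g i ≤ f i) → ∀ i → f i ∸ g i ≤ sum f ∸ sum g
term∸term≤sum∸sum g≤f i = ≤-trans (term≤sum _ i) (≤-reflexive (sym (sum-∸ g≤f)))

𝟙 : Bool → ℕ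
𝟙 b = if b then 1 else 0

𝟙*≤ : ∀ b x → 𝟙 b * x ≤ x
𝟙*≤ true x = ≤-reflexive (*-identityˡ x)
𝟙*≤ false x = z≤n

sum-split : ∀ {n} (P : Fin n → Bool) (f : Fin n → ℕ) →
  sum f ≡ sum (λ i → 𝟙 (P i) * f i) + sum (λ i → 𝟙 (not (P i)) * f i)
sum-split P f = trans (sum-cong-≗ λ i → split (P i) (f i)) (∑-distrib-+ (λ i → 𝟙 (P i) * f i) _)
  where
  split : ∀ b x → x ≡ 𝟙 b * x + 𝟙 (not b) * x
  split true x = sym (trans (+-identityʳ _) (*-identityˡ x))
  split false x = sym (+-identityʳ x)

divFloor*d≤m : ∀ m d → divFloor m d * d ≤ m
divFloor*d≤m m zero = z≤n
divFloor*d≤m m (suc d) = m/n*n≤m m (suc d)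

divFloor>0 : ∀ {m d} → 1 ≤ d → d ≤ m → 1 ≤ divFloor m d
divFloor>0 {d = suc d} _ d≤m = m≥n⇒m/n>0 d≤m

m<[1+divFloor]*d : ∀ m {d} → 1 ≤ d → m < suc (divFloor m d) * d
m<[1+divFloor]*d m {suc d} _ = begin-strict
  m                              ≡⟨ m≡m%n+[m/n]*n m (suc d) ⟩
  m % suc d + m / suc d * suc d  <⟨ +-monoˡ-< (m / suc d * suc d) (m%n<n m (suc d)) ⟩
  suc d + m / suc d * suc d      ∎
  where open ≤-Reasoning

pointMass : ∀ {n} → Fin n → ℕ → Fin n → ℕ
pointMass u k v = if does (v ≟ u) then k else 0

pointMass-off : ∀ {n} (u : Fin n) k {v} → v ≢ u → pointMass u k v ≡ 0
pointMass-off u k {v} v≢u with v ≟ u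
... | yes v≡u = ⊥-elim (v≢u v≡u)
... | no _ = refl

pointMass-at : ∀ {n} (u : Fin n) k → pointMass u k u ≡ k
pointMass-at u k with u ≟ u
... | yes _ = refl
... | no u≢u = ⊥-elim (u≢u refl)

sum-pointMass : ∀ {n} (u : Fin n) k → sum (pointMass u k) ≡ k
sum-pointMass u k = trans (sum-supportedAt _ u λ _ → pointMass-off u k) (pointMass-at u k)

sum-*pointMass : ∀ {n} (f : Fin n → ℕ) u k → sum (λ w → f w * pointMass u k w) ≡ f u * k
sum-*pointMass f u k = trans
  (sum-supportedAt _ u λ w w≢u → trans (cong (f w *_) (pointMass-off u k w≢u)) (*-zeroʳ (f w)))
  (cong (f u *_) (pointMass-at u k))

data SuffixDominant (D : ℕ) : List ℕ → Set where
  []       : SuffixDominant D []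
  dominant : ∀ {x xs} → 1 ≤ x → x + sumˡ xs ≤ D * x → SuffixDominant D xs →
             SuffixDominant D (x ∷ xs)

sumˡ-drop≤ : ∀ j (xs : List ℕ) → sumˡ (drop j xs) ≤ sumˡ xs
sumˡ-drop≤ zero xs = ≤-refl
sumˡ-drop≤ (suc j) [] = z≤n
sumˡ-drop≤ (suc j) (x ∷ xs) = ≤-trans (sumˡ-drop≤ j xs) (m≤n+m _ x)

SuffixDominant-drop : ∀ {D} j {xs} → SuffixDominant D xs → SuffixDominant D (drop j xs)
SuffixDominant-drop zero ds = ds
SuffixDominant-drop (suc j) [] = []
SuffixDominant-drop (suc j) (dominant _ _ ds) = SuffixDominant-drop j ds

SuffixDominant-decay : ∀ {D} j {xs} → SuffixDominant D xs →
  (j + D) * sumˡ (drop j xs) ≤ D * sumˡ xs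
SuffixDominant-decay zero ds = ≤-refl
SuffixDominant-decay {D} (suc j) [] = ≤-reflexive (trans (*-zeroʳ (suc j + D)) (sym (*-zeroʳ D)))
SuffixDominant-decay {D} (suc j) {x ∷ xs} (dominant _ x+S≤Dx ds) = begin
  S′ + (j + D) * S′  ≤⟨ +-mono-≤ S′≤Dx (SuffixDominant-decay j ds) ⟩
  D * x + D * sumˡ xs ≡⟨ *-distribˡ-+ D x (sumˡ xs) ⟨
  D * (x + sumˡ xs)   ∎
  where
  open ≤-Reasoning
  S′ : ℕ
  S′ = sumˡ (drop j xs)
  S′≤Dx : S′ ≤ D * x
  S′≤Dx = ≤-trans (sumˡ-drop≤ j xs) (≤-trans (m≤n+m (sumˡ xs) x) x+S≤Dx)

SuffixDominant-halves : ∀ {D xs} → SuffixDominant D xs → 2 * sumˡ (drop D xs) ≤ sumˡ xs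
SuffixDominant-halves {D} [] = ≤-reflexive (cong (λ ys → 2 * sumˡ ys) (drop-[] D))
SuffixDominant-halves {zero} (dominant {x} 1≤x x+S≤0 _) = ⊥-elim (<⇒≱ 1≤x (m+n≤o⇒m≤o x x+S≤0))
SuffixDominant-halves {D@(suc _)} {xs} ds@(dominant _ _ _) = *-cancelˡ-≤ D (begin
  D * (2 * sumˡ (drop D xs))  ≡⟨ regroup D (sumˡ (drop D xs)) ⟩
  (D + D) * sumˡ (drop D xs)  ≤⟨ SuffixDominant-decay D ds ⟩
  D * sumˡ xs                 ∎)
  where
  open ≤-Reasoning
  regroup : ∀ d s → d * (2 * s) ≡ (d + d) * s
  regroup = solve-∀

SuffixDominant-length : ∀ {D xs} m → SuffixDominant D xs → sumˡ xs < 2 ^ m → length xs ≤ m * D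
SuffixDominant-length zero [] _ = z≤n
SuffixDominant-length zero (dominant 1≤x _ _) S<1 = ⊥-elim (<⇒≱ S<1 (≤-trans 1≤x (m≤m+n _ _)))
SuffixDominant-length {D} {xs} (suc m) ds S<2^1+m = begin
  length xs                   ≤⟨ m≤n+m∸n (length xs) D ⟩
  D + (length xs ∸ D)         ≡⟨ cong (D +_) (length-drop D xs) ⟨
  D + length (drop D xs)      ≤⟨ +-monoʳ-≤ D (SuffixDominant-length m (SuffixDominant-drop D ds) S′<2^m) ⟩
  D + m * D                   ∎
  where
  open ≤-Reasoning
  S′<2^m : sumˡ (drop D xs) < 2 ^ m
  S′<2^m = *-cancelˡ-< 2 _ _ (≤-<-trans (SuffixDominant-halves ds) S<2^1+m)

m<2^[1+⌊log₂m⌋] : ∀ m → m < 2 ^ suc ⌊log₂ m ⌋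
m<2^[1+⌊log₂m⌋] m with 2 ^ suc ⌊log₂ m ⌋ ≤? m
... | no 2^[1+L]≰m = ≰⇒> 2^[1+L]≰m
... | yes 2^[1+L]≤m = ⊥-elim (n≮n ⌊log₂ m ⌋
  (subst (_≤ ⌊log₂ m ⌋) (⌊log₂[2^n]⌋≡n (suc ⌊log₂ m ⌋)) (⌊log₂⌋-mono-≤ 2^[1+L]≤m)))

m*n*m<2^[2+2⌊log₂[m*n]⌋] : ∀ m n → 1 ≤ n → m * n * m < 2 ^ (suc ⌊log₂ (m * n) ⌋ + suc ⌊log₂ (m * n) ⌋)
m*n*m<2^[2+2⌊log₂[m*n]⌋] m n 1≤n = begin-strict
  m * n * m          ≤⟨ *-monoʳ-≤ (m * n) (m≤m*n m n {{>-nonZero 1≤n}}) ⟩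
  m * n * (m * n)    <⟨ *-mono-< (m<2^[1+⌊log₂m⌋] (m * n)) (m<2^[1+⌊log₂m⌋] (m * n)) ⟩
  2 ^ suc L * 2 ^ suc L ≡⟨ ^-distribˡ-+-* 2 (suc L) (suc L) ⟨
  2 ^ (suc L + suc L) ∎
  where
  open ≤-Reasoning
  L : ℕ
  L = ⌊log₂ (m * n) ⌋

distinct⇒2≤n : ∀ {n} {u v : Fin n} → u ≢ v → 2 ≤ n
distinct⇒2≤n {suc zero} {zero} {zero} u≢v = ⊥-elim (u≢v refl)
distinct⇒2≤n {suc (suc n)} _ = s≤s (s≤s z≤n)

offSink : ∀ {n} → Fin n → Config n → Fin n → ℕ
offSink s σ v = if does (v ≟ s) then 0 else σ v

chipsOffSink≡sum : ∀ {n} (s : Fin n) σ → chipsOffSink s σ ≡ sum (offSink s σ)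
chipsOffSink≡sum s σ = sumˡ-allFin (offSink s σ)

offSink-≢ : ∀ {n} {s v : Fin n} (σ : Config n) → v ≢ s → offSink s σ v ≡ σ v
offSink-≢ {s = s} {v} σ v≢s with v ≟ s
... | yes v≡s = ⊥-elim (v≢s v≡s)
... | no _ = refl

≤chipsOffSink : ∀ {n} {s v : Fin n} (σ : Config n) → v ≢ s → σ v ≤ chipsOffSink s σ
≤chipsOffSink {s = s} {v} σ v≢s = begin
  σ v               ≡⟨ offSink-≢ σ v≢s ⟨
  offSink s σ v     ≤⟨ term≤sum (offSink s σ) v ⟩
  sum (offSink s σ) ≡⟨ chipsOffSink≡sum s σ ⟨
  chipsOffSink s σ  ∎
  where open ≤-Reasoning

[2+2L]*2Δc≤8*ΔΔcL : ∀ {Δ L} c → 1 ≤ Δ → 1 ≤ L →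
  (suc L + suc L) * (2 * (Δ * c)) ≤ 8 * (Δ * Δ * c * L)
[2+2L]*2Δc≤8*ΔΔcL {Δ} {L} c 1≤Δ 1≤L = begin
  (suc L + suc L) * (2 * (Δ * c))  ≤⟨ *-monoˡ-≤ (2 * (Δ * c)) (+-mono-≤ 1+L≤2L 1+L≤2L) ⟩
  (L + L + (L + L)) * (2 * (Δ * c)) ≡⟨ regroup L Δ c ⟩
  8 * (Δ * c * L)                   ≤⟨ *-monoʳ-≤ 8 (*-monoˡ-≤ L (*-monoˡ-≤ c (m≤m*n Δ Δ {{>-nonZero 1≤Δ}}))) ⟩
  8 * (Δ * Δ * c * L)               ∎
  where
  open ≤-Reasoning
  1+L≤2L : suc L ≤ L + L
  1+L≤2L = +-monoˡ-≤ L 1≤L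
  regroup : ∀ L Δ c → (L + L + (L + L)) * (2 * (Δ * c)) ≡ 8 * (Δ * c * L)
  regroup = solve-∀

module _ {n : ℕ} (G : Graph n) where

  A : Fin n → Fin n → ℕ
  A v w = 𝟙 (adj G v w)

  A-sym : ∀ v w → A v w ≡ A w v
  A-sym v w = cong 𝟙 (Graph.sym G v w)

  deg≡sumA : ∀ v → deg G v ≡ sum (A v)
  deg≡sumA v = sumˡ-allFin (A v)

  adj⇒1≤deg : ∀ {v w} → adj G v w ≡ true → 1 ≤ deg G v
  adj⇒1≤deg {v} {w} vw = begin
    1         ≡⟨ cong 𝟙 (sym vw) ⟩
    A v w     ≤⟨ term≤sum (A v) w ⟩
    sum (A v) ≡⟨ sym (deg≡sumA v) ⟩
    deg G v   ∎
    where open ≤-Reasoning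

  connected⇒1≤deg : Connected G → ∀ {v s} → v ≢ s → 1 ≤ deg G v
  connected⇒1≤deg conn {v} {s} v≢s with conn v s
  ... | here = ⊥-elim (v≢s refl)
  ... | step vw _ = adj⇒1≤deg vw

  -- σ − L O ≥ 0 off the sink, L the Laplacian of G: firing each v exactly
  -- O v times from σ leaves no negative pile.
  Affordable : Fin n → Config n → (Fin n → ℕ) → Set
  Affordable s σ O = ∀ v → v ≢ s → deg G v * O v ≤ σ v + sum (λ w → A v w * O w)

  within across : (Fin n → Bool) → Fin n → Fin n → ℕ
  within U v w = 𝟙 (U v) * 𝟙 (U w) * A v w
  across U v w = 𝟙 (U v) * 𝟙 (not (U w)) * A v w

  within-sym : ∀ U v w → within U v w ≡ within U w v
  within-sym U v w =
    cong₂ _*_ (*-comm (𝟙 (U v)) (𝟙 (U w))) (A-sym v w)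

  restrict-split : ∀ U v (h : Fin n → ℕ) →
    𝟙 (U v) * sum (λ w → A v w * h w) ≡
      sum (λ w → within U v w * h w) + sum (λ w → across U v w * h w)
  restrict-split U v h = begin
    𝟙 (U v) * sum (λ w → A v w * h w)
      ≡⟨ *-distribˡ-sum (𝟙 (U v)) (λ w → A v w * h w) ⟩
    sum (λ w → 𝟙 (U v) * (A v w * h w))
      ≡⟨ sum-split U (λ w → 𝟙 (U v) * (A v w * h w)) ⟩
    sum (λ w → 𝟙 (U w) * (𝟙 (U v) * (A v w * h w))) +
      sum (λ w → 𝟙 (not (U w)) * (𝟙 (U v) * (A v w * h w)))
      ≡⟨ cong₂ _+_ (sum-cong-≗ λ w → reorder (𝟙 (U w)) (𝟙 (U v)) (A v w) (h w))
                   (sum-cong-≗ λ w → reorder (𝟙 (not (U w))) (𝟙 (U v)) (A v w) (h w)) ⟩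
    sum (λ w → within U v w * h w) + sum (λ w → across U v w * h w) ∎
    where
    open ≡-Reasoning
    reorder : ∀ y x a z → y * (x * (a * z)) ≡ x * y * a * z
    reorder = solve-∀

  sum-restrict≤chipsOffSink : ∀ {s} (σ : Config n) (U : Fin n → Bool) → U s ≡ false →
    sum (λ v → 𝟙 (U v) * σ v) ≤ chipsOffSink s σ
  sum-restrict≤chipsOffSink {s} σ U Us =
    subst (sum (λ v → 𝟙 (U v) * σ v) ≤_) (sym (chipsOffSink≡sum s σ)) (sum-mono-≤ restrict≤)
    where
    restrict≤ : ∀ v → 𝟙 (U v) * σ v ≤ offSink s σ v
    restrict≤ v with v ≟ s
    ... | yes refl rewrite Us = z≤n
    ... | no _ = 𝟙*≤ (U v) (σ v)

  flux≤ : ∀ {s σ O} (U : Fin n → Bool) → U s ≡ false → Affordable s σ O →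
    sum (λ v → sum (λ w → across U v w * O v)) ≤
      sum (λ v → 𝟙 (U v) * σ v) + sum (λ v → sum (λ w → across U v w * O w))
  flux≤ {s} {σ} {O} U Us aff = +-cancelˡ-≤ inside _ _ (begin
    inside + out
      ≡⟨ ∑-distrib-+ (λ v → sum (λ w → within U v w * O v)) _ ⟨
    sum (λ v → sum (λ w → within U v w * O v) + sum (λ w → across U v w * O v))
      ≡⟨ sum-cong-≗ restricted-deg ⟨
    sum (λ v → 𝟙 (U v) * (deg G v * O v))
      ≤⟨ sum-mono-≤ restricted-aff ⟩
    sum (λ v → 𝟙 (U v) * σ v + 𝟙 (U v) * sum (λ w → A v w * O w))
      ≡⟨ ∑-distrib-+ (λ v → 𝟙 (U v) * σ v) _ ⟩
    chipsᵤ + sum (λ v → 𝟙 (U v) * sum (λ w → A v w * O w))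
      ≡⟨ cong (chipsᵤ +_) (sum-cong-≗ λ v → restrict-split U v O) ⟩
    chipsᵤ + sum (λ v → sum (λ w → within U v w * O w) + sum (λ w → across U v w * O w))
      ≡⟨ cong (chipsᵤ +_) (∑-distrib-+ (λ v → sum (λ w → within U v w * O w)) _) ⟩
    chipsᵤ + (inside′ + out′)
      ≡⟨ cong (λ i → chipsᵤ + (i + out′)) inside≡inside′ ⟨
    chipsᵤ + (inside + out′)
      ≡⟨ regroup chipsᵤ inside out′ ⟩
    inside + (chipsᵤ + out′) ∎)
    where
    open ≤-Reasoning
    inside inside′ out out′ chipsᵤ : ℕ
    inside = sum (λ v → sum (λ w → within U v w * O v))
    inside′ = sum (λ v → sum (λ w → within U v w * O w))
    out = sum (λ v → sum (λ w → across U v w * O v))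
    out′ = sum (λ v → sum (λ w → across U v w * O w))
    chipsᵤ = sum (λ v → 𝟙 (U v) * σ v)

    regroup : ∀ c i o → c + (i + o) ≡ i + (c + o)
    regroup = solve-∀

    inside≡inside′ : inside ≡ inside′
    inside≡inside′ = trans
      (sum-cong-≗ λ v → sum-cong-≗ λ w → cong (_* O v) (within-sym U v w))
      (∑-comm (λ v w → within U w v * O v))

    restricted-deg : ∀ v → 𝟙 (U v) * (deg G v * O v) ≡
      sum (λ w → within U v w * O v) + sum (λ w → across U v w * O v)
    restricted-deg v = trans
      (cong (𝟙 (U v) *_) (trans (cong (_* O v) (deg≡sumA v)) (*-distribʳ-sum (O v) (A v))))
      (restrict-split U v (λ _ → O v))

    restricted-aff : ∀ v → 𝟙 (U v) * (deg G v * O v) ≤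
      𝟙 (U v) * σ v + 𝟙 (U v) * sum (λ w → A v w * O w)
    restricted-aff v with U v in Uv
    ... | false = z≤n
    ... | true = ≤-trans (*-monoʳ-≤ 1 (aff v v≢s)) (≤-reflexive (*-distribˡ-+ 1 (σ v) _))
      where
      v≢s : v ≢ s
      v≢s refl with trans (sym Uv) Us
      ... | ()

  atLeast : (Fin n → ℕ) → ℕ → Fin n → Bool
  atLeast O t v = t ≤ᵇ O v

  gap≤chipsOffSink : ∀ {s σ O} → O s ≡ 0 → Affordable s σ O →
    ∀ {t x y} → 1 ≤ t → adj G x y ≡ true → t ≤ O x → O y < t →
    O x ∸ O y ≤ chipsOffSink s σ
  gap≤chipsOffSink {s} {σ} {O} Os aff {t} {x} {y} 1≤t xy t≤Ox Oy<t = begin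
    O x ∸ O y
      ≡⟨ cong₂ _∸_ (*-identityˡ (O x)) (*-identityˡ (O y)) ⟨
    1 * O x ∸ 1 * O y
      ≡⟨ cong (λ c → c * O x ∸ c * O y) across-xy ⟨
    highEnd x y ∸ lowEnd x y
      ≤⟨ term∸term≤sum∸sum (lowEnd≤highEnd x) y ⟩
    sum (highEnd x) ∸ sum (lowEnd x)
      ≤⟨ term∸term≤sum∸sum (λ v → sum-mono-≤ (lowEnd≤highEnd v)) x ⟩
    sum (λ v → sum (highEnd v)) ∸ sum (λ v → sum (lowEnd v))
      ≤⟨ m≤n+o⇒m∸n≤o (sum (λ v → sum (highEnd v))) (sum (λ v → sum (lowEnd v)))
           (≤-trans (flux≤ U Us aff) (≤-reflexive (+-comm (sum (λ v → 𝟙 (U v) * σ v)) _))) ⟩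
    sum (λ v → 𝟙 (U v) * σ v)
      ≤⟨ sum-restrict≤chipsOffSink σ U Us ⟩
    chipsOffSink s σ ∎
    where
    open ≤-Reasoning
    U : Fin n → Bool
    U = atLeast O t
    highEnd lowEnd : Fin n → Fin n → ℕ
    highEnd v w = across U v w * O v
    lowEnd v w = across U v w * O w

    Us : U s ≡ false
    Us with t ≤ᵇ O s | ≤ᵇ-reflects-≤ t (O s)
    ... | true | ofʸ t≤Os = ⊥-elim (<⇒≱ 1≤t (subst (t ≤_) Os t≤Os))
    ... | false | _ = refl

    across-xy : across U x y ≡ 1
    across-xy with t ≤ᵇ O x | ≤ᵇ-reflects-≤ t (O x) | t ≤ᵇ O y | ≤ᵇ-reflects-≤ t (O y)
    ... | true | _ | false | _ = trans (*-identityˡ (A x y)) (cong 𝟙 xy)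
    ... | false | ofⁿ t≰Ox | _ | _ = ⊥-elim (t≰Ox t≤Ox)
    ... | true | _ | true | ofʸ t≤Oy = ⊥-elim (<⇒≱ Oy<t t≤Oy)

    lowEnd≤highEnd : ∀ v w → lowEnd v w ≤ highEnd v w
    lowEnd≤highEnd v w with t ≤ᵇ O v | ≤ᵇ-reflects-≤ t (O v) | t ≤ᵇ O w | ≤ᵇ-reflects-≤ t (O w)
    ... | true | ofʸ t≤Ov | false | ofⁿ t≰Ow = *-monoʳ-≤ (1 * A v w) (<⇒≤ (<-≤-trans (≰⇒> t≰Ow) t≤Ov))
    ... | true | _ | true | _ = z≤n
    ... | false | _ | _ | _ = z≤n

  path-crosses-level : ∀ (O : Fin n → ℕ) t {u w} → Reach G u w → t ≤ O u → O w < t →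
    ∃ λ x → ∃ λ y → adj G x y ≡ true × t ≤ O x × O y < t
  path-crosses-level O t here t≤Ou Ou<t = ⊥-elim (<⇒≱ Ou<t t≤Ou)
  path-crosses-level O t (step {u} {v} uv v⇝w) t≤Ou Ow<t with t ≤? O v
  ... | yes t≤Ov = path-crosses-level O t v⇝w t≤Ov Ow<t
  ... | no t≰Ov = u , v , uv , t≤Ou , ≰⇒> t≰Ov

  below : (Fin n → ℕ) → Fin n → ℕ
  below O v = sum (λ w → 𝟙 (O w <ᵇ O v))

  below≤n : ∀ O v → below O v ≤ n
  below≤n O v = subst (below O v ≤_) (*-identityʳ n) (sum≤n*c 1 λ w → 𝟙≤1 (O w <ᵇ O v))
    where
    𝟙≤1 : ∀ b → 𝟙 b ≤ 1
    𝟙≤1 true = ≤-refl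
    𝟙≤1 false = z≤n

  below-mono-< : ∀ O {y v} → O y < O v → below O y < below O v
  below-mono-< O {y} {v} Oy<Ov = sum-mono-< below-mono y y-counted
    where
    below-mono : ∀ w → 𝟙 (O w <ᵇ O y) ≤ 𝟙 (O w <ᵇ O v)
    below-mono w with O w <ᵇ O y | <ᵇ-reflects-< (O w) (O y)
                    | O w <ᵇ O v | <ᵇ-reflects-< (O w) (O v)
    ... | false | _ | _ | _ = z≤n
    ... | true | _ | true | _ = ≤-refl
    ... | true | ofʸ Ow<Oy | false | ofⁿ Ow≮Ov = ⊥-elim (Ow≮Ov (<-trans Ow<Oy Oy<Ov))
    y-counted : 𝟙 (O y <ᵇ O y) < 𝟙 (O y <ᵇ O v)
    y-counted with O y <ᵇ O y | <ᵇ-reflects-< (O y) (O y)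
                 | O y <ᵇ O v | <ᵇ-reflects-< (O y) (O v)
    ... | false | _ | true | _ = s≤s z≤n
    ... | true | ofʸ Oy<Oy | _ | _ = ⊥-elim (n≮n (O y) Oy<Oy)
    ... | _ | _ | false | ofⁿ Oy≮Ov = ⊥-elim (Oy≮Ov Oy<Ov)

  affordable⇒≤chipsOffSink*n : Connected G → ∀ {s σ O} → O s ≡ 0 → Affordable s σ O →
    ∀ v → O v ≤ chipsOffSink s σ * n
  affordable⇒≤chipsOffSink*n conn {s} {σ} {O} Os aff v =
    ≤-trans (≤N*below v (On.wellFounded O <-wellFounded v)) (*-monoʳ-≤ N (below≤n O v))
    where
    N : ℕ
    N = chipsOffSink s σ
    -- A path from v to the sink leaves the level set {O ≥ O v} through an edge
    -- x y of gap at most N, and y is counted in below O v but not in below O y.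
    ≤N*below : ∀ v → Acc (_<_ on O) v → O v ≤ N * below O v
    ≤N*below v (acc rec) with 0 <? O v
    ... | no 0≮Ov = ≤-trans (≮⇒≥ 0≮Ov) z≤n
    ... | yes 0<Ov with path-crosses-level O (O v) (conn v s) ≤-refl (subst (_< O v) (sym Os) 0<Ov)
    ...   | x , y , xy , Ov≤Ox , Oy<Ov = begin
      O v                 ≤⟨ Ov≤Ox ⟩
      O x                 ≤⟨ m≤n+m∸n (O x) (O y) ⟩
      O y + (O x ∸ O y)   ≤⟨ +-mono-≤ (≤N*below y (rec Oy<Ov)) (gap≤chipsOffSink Os aff 0<Ov xy Ov≤Ox Oy<Ov) ⟩
      N * below O y + N   ≡⟨ trans (+-comm _ N) (sym (*-suc N (below O y))) ⟩
      N * suc (below O y) ≤⟨ *-monoʳ-≤ N (below-mono-< O Oy<Ov) ⟩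
      N * below O v       ∎
      where open ≤-Reasoning

module _ {n : ℕ} {G : Graph n} {s : Fin n} where

  greedyFire-balance : ∀ σ u {v} → v ≢ s →
    greedyFire G s σ u v + deg G v * pointMass u (quot G σ u) v ≡ σ v + A G u v * quot G σ u
  greedyFire-balance σ u {v} v≢s with v ≟ u
  ... | yes refl rewrite irrefl G v | *-comm (deg G v) (quot G σ v) | +-identityʳ (σ v) =
    m∸n+n≡m (divFloor*d≤m (σ v) (deg G v))
  ... | no _ with v ≟ s
  ...   | yes v≡s = ⊥-elim (v≢s v≡s)
  ...   | no _ with adj G u v
  ...     | true rewrite *-zeroʳ (deg G v) | +-identityʳ (σ v + quot G σ u)
                       | *-identityˡ (quot G σ u) = refl
  ...     | false rewrite *-zeroʳ (deg G v) = refl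

  odometer : ∀ {k σ τ} → GreedyRun G s k σ τ → Fin n → ℕ
  odometer done v = 0
  odometer (next {σ = σ} (greedy u _ _ _) r) v = pointMass u (quot G σ u) v + odometer r v

  amounts : ∀ {k σ τ} → GreedyRun G s k σ τ → List ℕ
  amounts done = []
  amounts (next {σ = σ} (greedy u _ _ _) r) = quot G σ u ∷ amounts r

  length-amounts : ∀ {k σ τ} (r : GreedyRun G s k σ τ) → length (amounts r) ≡ k
  length-amounts done = refl
  length-amounts (next (greedy _ _ _ _) r) = cong suc (length-amounts r)

  sum-odometer : ∀ {k σ τ} (r : GreedyRun G s k σ τ) → sum (odometer r) ≡ sumˡ (amounts r)
  sum-odometer done = sum-replicate-zero n
  sum-odometer (next {σ = σ} (greedy u _ _ _) r) = trans
    (∑-distrib-+ (pointMass u (quot G σ u)) (odometer r))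
    (cong₂ _+_ (sum-pointMass u (quot G σ u)) (sum-odometer r))

  odometer-sink : ∀ {k σ τ} (r : GreedyRun G s k σ τ) → odometer r s ≡ 0
  odometer-sink done = refl
  odometer-sink (next (greedy u u≢s _ _) r) =
    cong₂ _+_ (pointMass-off u _ (u≢s ∘ sym)) (odometer-sink r)

  odometer-balance : ∀ {k σ τ} (r : GreedyRun G s k σ τ) → ∀ {v} → v ≢ s →
    deg G v * odometer r v + τ v ≡ σ v + sum (λ w → A G v w * odometer r w)
  odometer-balance {σ = σ} done {v} _ = begin
    deg G v * 0 + σ v                  ≡⟨ cong (_+ σ v) (*-zeroʳ (deg G v)) ⟩
    σ v                                ≡⟨ +-identityʳ (σ v) ⟨
    σ v + 0                            ≡⟨ cong (σ v +_) (sum-replicate-zero n) ⟨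
    σ v + sum {n} (λ _ → 0)            ≡⟨ cong (σ v +_) (sum-cong-≗ λ w → *-zeroʳ (A G v w)) ⟨
    σ v + sum (λ w → A G v w * 0)      ∎
    where open ≡-Reasoning
  odometer-balance {σ = σ} {τ} (next (greedy u _ _ _) r) {v} v≢s = begin
    d * (P v + O v) + τ v
      ≡⟨ regroup d (P v) (O v) (τ v) ⟩
    d * P v + (d * O v + τ v)
      ≡⟨ cong (d * P v +_) (odometer-balance r v≢s) ⟩
    d * P v + (greedyFire G s σ u v + sum (λ w → A G v w * O w))
      ≡⟨ swap (d * P v) (greedyFire G s σ u v) (sum (λ w → A G v w * O w)) ⟩
    greedyFire G s σ u v + d * P v + sum (λ w → A G v w * O w)
      ≡⟨ cong (_+ sum (λ w → A G v w * O w)) (greedyFire-balance σ u v≢s) ⟩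
    σ v + A G u v * k + sum (λ w → A G v w * O w)
      ≡⟨ cong (λ a → σ v + a + sum (λ w → A G v w * O w)) (trans (sum-*pointMass (A G v) u k) (cong (_* k) (A-sym G v u))) ⟨
    σ v + sum (λ w → A G v w * P w) + sum (λ w → A G v w * O w)
      ≡⟨ +-assoc (σ v) _ _ ⟩
    σ v + (sum (λ w → A G v w * P w) + sum (λ w → A G v w * O w))
      ≡⟨ cong (σ v +_) (∑-distrib-+ (λ w → A G v w * P w) _) ⟨
    σ v + sum (λ w → A G v w * P w + A G v w * O w)
      ≡⟨ cong (σ v +_) (sum-cong-≗ λ w → *-distribˡ-+ (A G v w) (P w) (O w)) ⟨
    σ v + sum (λ w → A G v w * (P w + O w)) ∎
    where
    open ≡-Reasoning
    k d : ℕ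
    k = quot G σ u
    d = deg G v
    P O : Fin n → ℕ
    P = pointMass u k
    O = odometer r
    regroup : ∀ d p o t → d * (p + o) + t ≡ d * p + (d * o + t)
    regroup = solve-∀
    swap : ∀ a b c → a + (b + c) ≡ b + a + c
    swap = solve-∀

  odometer-affordable : ∀ {k σ τ} (r : GreedyRun G s k σ τ) → Affordable G s σ (odometer r)
  odometer-affordable {τ = τ} r v v≢s =
    ≤-trans (m≤m+n _ (τ v)) (≤-reflexive (odometer-balance r v≢s))

module _ {n Δ : ℕ} {G : Graph n} {s : Fin n} (conn : Connected G) (maxDeg : MaxDegreeAtMost G Δ) where

  chipsOffSink≤ : ∀ {σ x} → (∀ v → v ≢ s → quot G σ v ≤ x) → chipsOffSink s σ ≤ n * (suc x * Δ)
  chipsOffSink≤ {σ} {x} quot≤x =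
    subst (_≤ n * (suc x * Δ)) (sym (chipsOffSink≡sum s σ)) (sum≤n*c (suc x * Δ) offSink≤)
    where
    offSink≤ : ∀ v → offSink s σ v ≤ suc x * Δ
    offSink≤ v with v ≟ s
    ... | yes _ = z≤n
    ... | no v≢s = ≤-trans (<⇒≤ (m<[1+divFloor]*d (σ v) (connected⇒1≤deg G conn v≢s)))
                           (*-mono-≤ (s≤s (quot≤x v v≢s)) (maxDeg v))

  sumˡ-amounts≤ : ∀ {k σ τ} (r : GreedyRun G s k σ τ) → sumˡ (amounts r) ≤ n * (chipsOffSink s σ * n)
  sumˡ-amounts≤ {σ = σ} r = subst (_≤ n * (chipsOffSink s σ * n)) (sum-odometer r)
    (sum≤n*c _ (affordable⇒≤chipsOffSink*n G conn (odometer-sink r) (odometer-affordable r)))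

  amounts-dominant : ∀ {k σ τ} (r : GreedyRun G s k σ τ) →
    SuffixDominant (2 * (Δ * (n * n * n))) (amounts r)
  amounts-dominant done = []
  amounts-dominant r@(next {σ = σ} (greedy u u≢s full maximal) r′) =
    dominant 1≤x x+rest≤ (amounts-dominant r′)
    where
    x : ℕ
    x = quot G σ u
    1≤x : 1 ≤ x
    1≤x = divFloor>0 (connected⇒1≤deg G conn u≢s) full
    x+rest≤ : x + sumˡ (amounts r′) ≤ 2 * (Δ * (n * n * n)) * x
    x+rest≤ = begin
      x + sumˡ (amounts r′)          ≤⟨ sumˡ-amounts≤ r ⟩
      n * (chipsOffSink s σ * n)     ≤⟨ *-monoʳ-≤ n (*-monoˡ-≤ n (chipsOffSink≤ maximal)) ⟩
      n * (n * (suc x * Δ) * n)      ≡⟨ regroup n (suc x) Δ ⟩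
      suc x * (Δ * (n * n * n))      ≤⟨ *-monoˡ-≤ (Δ * (n * n * n)) (+-monoˡ-≤ x 1≤x) ⟩
      (x + x) * (Δ * (n * n * n))    ≡⟨ regroup′ x (Δ * (n * n * n)) ⟩
      2 * (Δ * (n * n * n)) * x      ∎
      where
      open ≤-Reasoning
      regroup : ∀ n y Δ → n * (n * (y * Δ) * n) ≡ y * (Δ * (n * n * n))
      regroup = solve-∀
      regroup′ : ∀ x c → (x + x) * c ≡ 2 * c * x
      regroup′ = solve-∀

  greedyRun-length≤ : ∀ {k σ τ} → GreedyRun G s k σ τ →
    k ≤ 8 * (Δ * Δ * (n * n * n) * ⌊log₂ (n * chipsOffSink s σ) ⌋)
  greedyRun-length≤ done = z≤n
  greedyRun-length≤ {k} {σ} r@(next (greedy u u≢s full _) _) = begin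
    k                                          ≡⟨ length-amounts r ⟨
    length (amounts r)                         ≤⟨ SuffixDominant-length (suc L + suc L) (amounts-dominant r) sum< ⟩
    (suc L + suc L) * (2 * (Δ * (n * n * n)))  ≤⟨ [2+2L]*2Δc≤8*ΔΔcL (n * n * n) 1≤Δ 1≤L ⟩
    8 * (Δ * Δ * (n * n * n) * L)              ∎
    where
    open ≤-Reasoning
    N L : ℕ
    N = chipsOffSink s σ
    L = ⌊log₂ (n * N) ⌋
    1≤deg : 1 ≤ deg G u
    1≤deg = connected⇒1≤deg G conn u≢s
    1≤N : 1 ≤ N
    1≤N = ≤-trans 1≤deg (≤-trans full (≤chipsOffSink σ u≢s))
    1≤Δ : 1 ≤ Δ
    1≤Δ = ≤-trans 1≤deg (maxDeg u)
    1≤L : 1 ≤ L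
    1≤L = ⌊log₂⌋-mono-≤ (*-mono-≤ (distinct⇒2≤n u≢s) 1≤N)
    sum< : sumˡ (amounts r) < 2 ^ (suc L + suc L)
    sum< = ≤-<-trans (≤-trans (sumˡ-amounts≤ r) (≤-reflexive (sym (*-assoc n N n))))
                     (m*n*m<2^[2+2⌊log₂[m*n]⌋] n N 1≤N)

corollary4p11 : ∃ λ (C : ℕ) → ∀ (n Δ : ℕ) (G : Graph n) (s : Fin n) (σ : Config n) →
    Connected G → MaxDegreeAtMost G Δ →
    ∀ (k : ℕ) (τ : Config n) → GreedyRun G s k σ τ →
    k ≤ C * (Δ * Δ * (n * n * n) * ⌊log₂ (n * chipsOffSink s σ) ⌋)
corollary4p11 = 8 , λ n Δ G s σ conn maxDeg k τ run → greedyRun-length≤ conn maxDeg run
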